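{- Let $\mu$ be a weak composition of $n$. The set $\{\wedge(\sigma)\mid\sigma\in\mathfrak{S}_\mu\}$ spans $\mathcal{L}(\mu)$, and all linear relations among these generators are consequences of the relations $$\wedge(\alpha x^iy^i\beta)+\wedge(\alpha y^ix^i\beta)=0,$$ $$\wedge(\alpha x^iy^j\beta)+\wedge(\alpha y^jx^i\beta)+\wedge(\alpha y^ix^j\beta)+\wedge(\alpha x^jy^i\beta)=0,$$ for colors $i\ne j$ in $\operatorname{supp}(\mu)$ (and $i\in\operatorname{supp}(\mu)$ in the first relation), distinct $x,y\in[n]$ and colored words $\alpha,\beta$ such that the colored permutations involved lie in $\mathfrak{S}_\mu$.
   Context: Let $\mathbf{k}$ be a field of characteristic $\neq2$, $\mathbb{P}$ the positive integers. A weak composition is a sequence $\mu=(\mu(1),\mu(2),\dots)$ of nonnegative integers with $|\mu|=\sum\mu(i)<\infty$; $\operatorname{supp}(\mu)=\{j:\mu(j)\neq0\}$. A colored letter is $x^i=(x,i)\in[n]\times\mathbb{P}$; a colored permutation of $[n]$ is a word of colored letters whose uncolored letters form a permutation of $[n]$; its content counts letters of each color; $\mathfrak{S}_\mu$ is the set of colored permutations with content $\mu$; $\alpha x^iy^j\beta$ denotes concatenation of colored words. Let $W$ have basis $[n]\times\mathbb{P}$ and $\Lambda=T(W)/I$ with $I$ generated by $x^i\otimes y^i+y^i\otimes x^i$ and $x^i\otimes y^j+y^i\otimes x^j+y^j\otimes x^i+x^j\otimes y^i$ for all $x,y\in[n]$, $i,j\in\mathbb{P}$; $\wedge(\sigma)=\sigma(1)\wedge\cdots\wedge\sigma(n)$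 is the image of $\sigma(1)\otimes\cdots\otimes\sigma(n)$, and $\mathcal{L}(\mu)$ is the span of $\{\wedge(\sigma):\sigma\in\mathfrak{S}_\mu\}$. -}

module Defs where

open import Level using (Level; _⊔_)
open import Algebra.Bundles using (CommutativeRing)
open import Data.Nat as ℕ using (ℕ; zero; suc)
open import Data.Fin as Fin using (Fin)
open import Data.Fin.Properties as FinP using ()
open import Data.Nat.Properties as ℕP using ()
open import Data.Product using (Σ; _×_; _,_; proj₁; proj₂; ∃)
open import Data.Product.Properties using (≡-dec)
open import Data.List using (List; []; _∷_; _++_; map; length; allFin; filter; concatMap)
open import Data.Nat.ListAction using (sum)
open import Data.List.Properties as ListP using ()
open import Data.List.Relation.Unary.All using (All)
open import Data.List.Relation.Binary.Permutation.Propositional using (_↭_)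
open import Relation.Binary.PropositionalEquality using (_≡_)
open import Relation.Nullary using (¬_; Dec; yes; no)
open import Relation.Binary.Definitions using (DecidableEquality)

record Field (c ℓ : Level) : Set (Level.suc (c ⊔ ℓ)) where
  field
    commutativeRing : CommutativeRing c ℓ
  open CommutativeRing commutativeRing public
  field
    1≉0     : ¬ (1# ≈ 0#)
    inverse : ∀ x → ¬ (x ≈ 0#) → Σ Carrier (λ y → (x * y) ≈ 1#)

CharNot2 : ∀ {c ℓ} → Field c ℓ → Set ℓ
CharNot2 K = ¬ ((1# + 1#) ≈ 0#) where open Field K

-- Colors, colored letters, colored words
-- A color i ∈ ℙ is encoded by the natural number i ∸ 1 (color 1 ↦ 0).

Color : Set
Color = ℕ

Letter : ℕ → Set
Letter n = Fin n × Color

Word : ℕ → Set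
Word n = List (Letter n)

_≟L_ : ∀ {n} → DecidableEquality (Letter n)
_≟L_ = ≡-dec FinP._≟_ ℕP._≟_

_≟W_ : ∀ {n} → DecidableEquality (Word n)
_≟W_ = ListP.≡-dec _≟L_

-- weak composition: μ(1), μ(2), …, μ(m), and μ(i) = 0 for i > m
WeakComp : Set
WeakComp = List ℕ

-- μ(i+1) for the encoded color i
at : WeakComp → Color → ℕ
at []       _       = 0
at (m ∷ μ)  zero    = m
at (m ∷ μ)  (suc i) = at μ i

IsWeakCompOf : WeakComp → ℕ → Set
IsWeakCompOf μ n = sum μ ≡ n

InSupp : WeakComp → Color → Set
InSupp μ i = ¬ (at μ i ≡ 0)

count : ∀ {n} → Color → Word n → ℕ
count i [] = 0
count i ((x , j) ∷ w) with i ℕP.≟ j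
... | yes _ = suc (count i w)
... | no  _ = count i w

IsColoredPerm : ∀ {n} → Word n → Set
IsColoredPerm {n} w = map proj₁ w ↭ allFin n

InSμ : ∀ {n} → WeakComp → Word n → Set
InSμ μ w = IsColoredPerm w × (∀ i → count i w ≡ at μ i)

-- Formal linear combinations of words = elements of the tensor algebra
-- T(W) (W has basis [n] × ℙ); a word w₁…w_k stands for w₁ ⊗ ⋯ ⊗ w_k.

module Tensor {c ℓ} (K : Field c ℓ) (n : ℕ) where
  open Field K

  Comb : Set c
  Comb = List (Carrier × Word n)

  coeff : Comb → Word n → Carrier
  coeff [] w = 0#
  coeff ((a , u) ∷ t) w with u ≟W w
  ... | yes _ = a + coeff t w
  ... | no  _ = coeff t w

  _≋_ : Comb → Comb → Set ℓ
  s ≋ t = ∀ w → coeff s w ≈ coeff t w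

  scale : Carrier → Comb → Comb
  scale a t = map (λ p → (a * proj₁ p , proj₂ p)) t

  sandwich : Word n → Comb → Word n → Comb
  sandwich u r v = map (λ p → (proj₁ p , u ++ proj₂ p ++ v)) r

  gen₁ : Fin n → Fin n → Color → Comb
  gen₁ x y i = (1# , (x , i) ∷ (y , i) ∷ []) ∷ (1# , (y , i) ∷ (x , i) ∷ []) ∷ []

  gen₂ : Fin n → Fin n → Color → Color → Comb
  gen₂ x y i j = (1# , (x , i) ∷ (y , j) ∷ []) ∷ (1# , (y , i) ∷ (x , j) ∷ [])
               ∷ (1# , (y , j) ∷ (x , i) ∷ []) ∷ (1# , (x , j) ∷ (y , i) ∷ []) ∷ []

  data Generator : Comb → Set c where
    g₁ : ∀ x y i → Generator (gen₁ x y i)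
    g₂ : ∀ x y i j → Generator (gen₂ x y i j)

  record IdealTerm : Set c where
    constructor iterm
    field
      coef : Carrier
      left : Word n
      gen  : Comb
      isGen : Generator gen
      right : Word n
  open IdealTerm

  termComb : IdealTerm → Comb
  termComb t = scale (coef t) (sandwich (left t) (gen t) (right t))

  -- t ∈ I (I = two-sided ideal generated by the gen's = span of u ⊗ r ⊗ v)
  InIdeal : Comb → Set (c ⊔ ℓ)
  InIdeal t = ∃ λ (ts : List IdealTerm) → concatMap termComb ts ≋ t

  -- ∧(Σ c_σ σ) = Σ c_σ ∧(σ) = 0 in Λ = T(W)/I
  WedgeZero : Comb → Set (c ⊔ ℓ)
  WedgeZero = InIdeal

  rel₁ : Word n → Fin n → Fin n → Color → Word n → Comb
  rel₁ α x y i β = sandwich α (gen₁ x y i) β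

  rel₂ : Word n → Fin n → Fin n → Color → Color → Word n → Comb
  rel₂ α x y i j β = sandwich α (gen₂ x y i j) β

  data Relation (μ : WeakComp) : Comb → Set c where
    r₁ : ∀ α x y i β → ¬ (x ≡ y) → InSupp μ i
       → All (λ p → InSμ μ (proj₂ p)) (rel₁ α x y i β)
       → Relation μ (rel₁ α x y i β)
    r₂ : ∀ α x y i j β → ¬ (x ≡ y) → ¬ (i ≡ j) → InSupp μ i → InSupp μ j
       → All (λ p → InSμ μ (proj₂ p)) (rel₂ α x y i j β)
       → Relation μ (rel₂ α x y i j β)

  record RelTerm (μ : WeakComp) : Set c where
    constructor rterm
    field
      rcoef : Carrier
      rel   : Comb
      isRel : Relation μ rel
  open RelTerm

  InRelSpan : WeakComp → Comb → Set (c ⊔ ℓ)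
  InRelSpan μ t = ∃ λ (rs : List (RelTerm μ)) →
    concatMap (λ r → scale (rcoef r) (rel r)) rs ≋ t

  SupportedOn𝔖 : WeakComp → Comb → Set c
  SupportedOn𝔖 μ t = All (λ p → InSμ μ (proj₂ p)) t

-- The two-sided ideal I is homogeneous for the grading of T(W) by content (the multiset of
-- uncolored letters together with the multiset of colors): every elementary element
-- α ⊗ r ⊗ β, r a generator, has all its words of one content, and whether a word lies in 𝔖_μ
-- depends only on its content. So if t ∈ I is supported on 𝔖_μ and t = Σ τ with elementary τ,
-- discarding the τ whose content does not occur in t still leaves a sum equal to t (compare
-- coefficients content by content). Each remaining τ lives on 𝔖_μ, so its two letters are
-- distinct and its colors lie in supp(μ): it is one of the restricted relations.

module Submission where

open import Defs
open import Data.Nat using (ℕ)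
open import Data.Product using (_×_)
open import Function.Bundles using (_⇔_)

import Data.Nat as ℕ
import Data.Nat.Properties as ℕ
open import Data.Fin using (Fin)
import Data.Fin.Properties as Fin
open import Data.List using (List; []; _∷_; _++_; map; length; filter; concatMap)
import Data.List.Properties as List
open import Data.List.Relation.Binary.Permutation.Propositional as ↭
  using (_↭_; ↭-refl; ↭-sym; ↭-trans; ↭-reflexive; ↭⇒↭ₛ; ↭⇒↭ₛ′)
open import Data.List.Relation.Binary.Permutation.Propositional.Properties
  using (map⁺; zoom; shifts; filter-↭; ↭-length)
import Data.List.Relation.Binary.Permutation.Setoid.Properties as SetoidPermutation
open import Data.List.Relation.Binary.Pointwise using (Pointwise-≡⇒≡)
open import Data.List.Relation.Unary.All as All using (All; []; _∷_)
import Data.List.Relation.Unary.All.Properties as All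
open import Data.List.Relation.Unary.AllPairs using (_∷_)
open import Data.List.Relation.Unary.Any as Any using (Any; here; there; any?)
open import Data.List.Relation.Unary.Sorted.TotalOrder.Properties using (↗↭↗⇒≋)
open import Data.List.Relation.Unary.Unique.Propositional.Properties using (allFin⁺)
open import Data.Product using (_,_; proj₁; proj₂)
open import Function using (_∘_)
open import Function.Bundles using (mk⇔)
open import Relation.Binary.Bundles using (DecTotalOrder)
open import Relation.Binary.Core using (Rel)
open import Relation.Binary.Definitions using (Decidable)
open import Relation.Binary.PropositionalEquality as ≡ using (_≡_; cong)
open import Relation.Binary.Structures using (IsDecTotalOrder)
open import Relation.Nullary using (¬_; Dec; yes; no; contradiction)
open import Relation.Nullary.Decidable using (_×-dec_)
import Algebra.Properties.CommutativeSemigroup as CommutativeSemigroupProperties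

module _ {a ℓ} {A : Set a} {_≤_ : Rel A ℓ} (≤-isDecTotalOrder : IsDecTotalOrder _≡_ _≤_) where
  private
    O : DecTotalOrder a a ℓ
    O = record { isDecTotalOrder = ≤-isDecTotalOrder }
    open DecTotalOrder O using (_≟_; totalOrder; isEquivalence)
    open import Data.List.Sort.InsertionSort.Base O using (sort)
    open import Data.List.Sort.InsertionSort.Properties O using (sort-↭; sort-↗)

  ↭-dec : Decidable (_↭_ {A = A})
  ↭-dec xs ys with List.≡-dec _≟_ (sort xs) (sort ys)
  ... | yes sorts≡ = yes (↭-trans (↭-sym (sort-↭ xs)) (↭-trans (↭-reflexive sorts≡) (sort-↭ ys)))
  ... | no sorts≢ = no λ xs↭ys → sorts≢ (Pointwise-≡⇒≡ (↗↭↗⇒≋ totalOrder (sort-↗ xs) (sort-↗ ys)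
          (↭⇒↭ₛ′ isEquivalence (↭-trans (sort-↭ xs) (↭-trans xs↭ys (↭-sym (sort-↭ ys)))))))

↭-swap₂ : ∀ {A : Set} {a b : A} {xs} → a ∷ b ∷ xs ↭ b ∷ a ∷ xs
↭-swap₂ = ↭.swap _ _ ↭-refl

module _ {n : ℕ} where

  letters : Word n → List (Fin n)
  letters = map proj₁

  colors : Word n → List Color
  colors = map proj₂

  infix 4 _∼_
  _∼_ : Rel (Word n) _
  u ∼ v = letters u ↭ letters v × colors u ↭ colors v

  ∼-refl : ∀ {u} → u ∼ u
  ∼-refl = ↭-refl , ↭-refl

  ∼-sym : ∀ {u v} → u ∼ v → v ∼ u
  ∼-sym (p , q) = ↭-sym p , ↭-sym q

  ∼-trans : ∀ {u v w} → u ∼ v → v ∼ w → u ∼ w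
  ∼-trans (p , q) (p′ , q′) = ↭-trans p p′ , ↭-trans q q′

  _∼?_ : Decidable _∼_
  u ∼? v = ↭-dec Fin.≤-isDecTotalOrder (letters u) (letters v) ×-dec ↭-dec ℕ.≤-isDecTotalOrder (colors u) (colors v)

  ↭⇒∼ : ∀ {u v} → u ↭ v → u ∼ v
  ↭⇒∼ p = map⁺ proj₁ p , map⁺ proj₂ p

  ∼-zoom : ∀ α β {u v} → u ∼ v → α ++ u ++ β ∼ α ++ v ++ β
  ∼-zoom α β {u} {v} (p , q) = map-zoom proj₁ p , map-zoom proj₂ q
    where
    map-++₃ : ∀ {B : Set} (f : Letter n → B) w → map f (α ++ w ++ β) ≡ map f α ++ map f w ++ map f β
    map-++₃ f w = ≡.trans (List.map-++ f α (w ++ β)) (cong (map f α ++_) (List.map-++ f w β))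

    map-zoom : ∀ {B : Set} (f : Letter n → B) → map f u ↭ map f v → map f (α ++ u ++ β) ↭ map f (α ++ v ++ β)
    map-zoom f r = ↭-trans (↭-reflexive (map-++₃ f u))
      (↭-trans (zoom (map f α) r) (↭-reflexive (≡.sym (map-++₃ f v))))

  count-colors : ∀ i (w : Word n) → count i w ≡ length (filter (i ℕ.≟_) (colors w))
  count-colors i [] = ≡.refl
  count-colors i ((x , j) ∷ w) with i ℕ.≟ j
  ... | yes i≡j = ≡.trans (cong ℕ.suc (count-colors i w)) (cong length (≡.sym (List.filter-accept (i ℕ.≟_) i≡j)))
  ... | no i≢j = ≡.trans (count-colors i w) (cong length (≡.sym (List.filter-reject (i ℕ.≟_) i≢j)))

  count-resp-∼ : ∀ i {u v} → u ∼ v → count i u ≡ count i v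
  count-resp-∼ i {u} {v} (_ , q) = ≡.trans (count-colors i u)
    (≡.trans (↭-length (filter-↭ (i ℕ.≟_) q)) (≡.sym (count-colors i v)))

  count-∷-same : ∀ i x (w : Word n) → count i ((x , i) ∷ w) ≡ ℕ.suc (count i w)
  count-∷-same i x w with i ℕ.≟ i
  ... | yes _ = ≡.refl
  ... | no i≢i = contradiction ≡.refl i≢i

  module _ (μ : WeakComp) where

    InSμ-resp-∼ : ∀ {u v} → u ∼ v → InSμ μ u → InSμ μ v
    InSμ-resp-∼ u∼v@(p , _) (perm , cnt) =
      ↭-trans (↭-sym p) perm , λ i → ≡.trans (≡.sym (count-resp-∼ i u∼v)) (cnt i)

    InSμ-resp-↭ : ∀ {u v} → u ↭ v → InSμ μ u → InSμ μ v
    InSμ-resp-↭ = InSμ-resp-∼ ∘ ↭⇒∼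

    head-letters-distinct : ∀ {x y i j} {w : Word n} → InSμ μ ((x , i) ∷ (y , j) ∷ w) → ¬ x ≡ y
    head-letters-distinct (perm , _)
      with SetoidPermutation.Unique-resp-↭ (≡.setoid _) (↭⇒↭ₛ (↭-sym perm)) (allFin⁺ n)
    ... | (x≢y ∷ _) ∷ _ = x≢y

    head-color-inSupp : ∀ {x i} {w : Word n} → InSμ μ ((x , i) ∷ w) → InSupp μ i
    head-color-inSupp {x} {i} {w} (_ , cnt) μi≡0
      with ≡.trans (≡.sym (count-∷-same i x w)) (≡.trans (cnt i) μi≡0)
    ... | ()

    module _ (α β : Word n) {x y : Fin n} {i j : Color} (σ : InSμ μ (α ++ (x , i) ∷ (y , j) ∷ β)) where

      private
        σ-front : InSμ μ ((x , i) ∷ (y , j) ∷ α ++ β)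
        σ-front = InSμ-resp-↭ (shifts α ((x , i) ∷ (y , j) ∷ []) {β}) σ

      adjacent-letters-distinct : ¬ x ≡ y
      adjacent-letters-distinct = head-letters-distinct σ-front

      adjacent-colors-inSupp : InSupp μ i × InSupp μ j
      adjacent-colors-inSupp = head-color-inSupp σ-front , head-color-inSupp (InSμ-resp-↭ ↭-swap₂ σ-front)

module _ {c ℓ} (K : Field c ℓ) (n : ℕ) where
  open Field K
  open Tensor K n
  open CommutativeSemigroupProperties +-commutativeSemigroup using (x∙yz≈y∙xz)
  open import Relation.Binary.Reasoning.Setoid setoid

  coeff-++ : ∀ (s s′ : Comb) w → coeff (s ++ s′) w ≈ coeff s w + coeff s′ w
  coeff-++ [] s′ w = sym (+-identityˡ _)
  coeff-++ ((a , u) ∷ s) s′ w with u ≟W w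
  ... | yes _ = trans (+-cong refl (coeff-++ s s′ w)) (sym (+-assoc _ _ _))
  ... | no _ = coeff-++ s s′ w

  coeff-resp-↭ : ∀ {s s′ : Comb} → s ↭ s′ → ∀ w → coeff s w ≈ coeff s′ w
  coeff-resp-↭ ↭.refl w = refl
  coeff-resp-↭ {_ ∷ s} {_ ∷ s′} (↭.prep p s↭s′) w = begin
    coeff ((p ∷ []) ++ s) w        ≈⟨ coeff-++ (p ∷ []) s w ⟩
    coeff (p ∷ []) w + coeff s w   ≈⟨ +-cong refl (coeff-resp-↭ s↭s′ w) ⟩
    coeff (p ∷ []) w + coeff s′ w  ≈⟨ coeff-++ (p ∷ []) s′ w ⟨
    coeff ((p ∷ []) ++ s′) w       ∎
  coeff-resp-↭ {_ ∷ _ ∷ s} {_ ∷ _ ∷ s′} (↭.swap p q s↭s′) w = begin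
    coeff ((p ∷ []) ++ (q ∷ []) ++ s) w                  ≈⟨ coeff-∷∷ p q s ⟩
    coeff (p ∷ []) w + (coeff (q ∷ []) w + coeff s w)    ≈⟨ x∙yz≈y∙xz _ _ _ ⟩
    coeff (q ∷ []) w + (coeff (p ∷ []) w + coeff s w)    ≈⟨ +-cong refl (+-cong refl (coeff-resp-↭ s↭s′ w)) ⟩
    coeff (q ∷ []) w + (coeff (p ∷ []) w + coeff s′ w)   ≈⟨ coeff-∷∷ q p s′ ⟨
    coeff ((q ∷ []) ++ (p ∷ []) ++ s′) w                 ∎
    where
    coeff-∷∷ : ∀ p q s → coeff ((p ∷ []) ++ (q ∷ []) ++ s) w ≈ coeff (p ∷ []) w + (coeff (q ∷ []) w + coeff s w)
    coeff-∷∷ p q s = trans (coeff-++ (p ∷ []) _ w) (+-cong refl (coeff-++ (q ∷ []) s w))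
  coeff-resp-↭ (↭.trans p q) w = trans (coeff-resp-↭ p w) (coeff-resp-↭ q w)

  Homogeneous : Word n → Comb → Set c
  Homogeneous v s = All (λ p → proj₂ p ∼ v) s

  coeff-homogeneous : ∀ {v} (s : Comb) → Homogeneous v s → ∀ {w} → ¬ w ∼ v → coeff s w ≈ 0#
  coeff-homogeneous [] [] w≁v = refl
  coeff-homogeneous ((a , u) ∷ s) (u∼v ∷ s∼v) {w} w≁v with u ≟W w
  ... | yes ≡.refl = contradiction u∼v w≁v
  ... | no _ = coeff-homogeneous s s∼v w≁v

  ContentOccurs : Comb → Word n → Set c
  ContentOccurs s w = Any (λ p → proj₂ p ∼ w) s

  ContentOccurs? : ∀ s w → Dec (ContentOccurs s w)
  ContentOccurs? s w = any? (λ p → proj₂ p ∼? w) s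

  ContentOccurs-resp-∼ : ∀ {s u v} → u ∼ v → ContentOccurs s u → ContentOccurs s v
  ContentOccurs-resp-∼ u∼v = Any.map (λ p∼u → ∼-trans p∼u u∼v)

  coeff-absent : ∀ (s : Comb) {w} → ¬ ContentOccurs s w → coeff s w ≈ 0#
  coeff-absent [] _ = refl
  coeff-absent ((a , u) ∷ s) {w} ¬occ with u ≟W w
  ... | yes ≡.refl = contradiction (here ∼-refl) ¬occ
  ... | no _ = coeff-absent s (¬occ ∘ there)

  rel₁-homogeneous : ∀ α x y i β → Homogeneous (α ++ (x , i) ∷ (y , i) ∷ β) (rel₁ α x y i β)
  rel₁-homogeneous α x y i β = ∼-refl ∷ ∼-zoom α β (↭-swap₂ , ↭-refl) ∷ []

  rel₂-homogeneous : ∀ α x y i j β → Homogeneous (α ++ (x , i) ∷ (y , j) ∷ β) (rel₂ α x y i j β)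
  rel₂-homogeneous α x y i j β =
    ∼-refl ∷ ∼-zoom α β (↭-swap₂ , ↭-refl) ∷ ∼-zoom α β (↭-swap₂ , ↭-swap₂) ∷ ∼-zoom α β (↭-refl , ↭-swap₂) ∷ []

  scale-homogeneous : ∀ a {v s} → Homogeneous v s → Homogeneous v (scale a s)
  scale-homogeneous a = All.map⁺ {f = λ p → (a * proj₁ p , proj₂ p)}

  lead : IdealTerm → Word n
  lead (iterm _ α _ (g₁ x y i) β) = α ++ (x , i) ∷ (y , i) ∷ β
  lead (iterm _ α _ (g₂ x y i j) β) = α ++ (x , i) ∷ (y , j) ∷ β

  termComb-homogeneous : ∀ τ → Homogeneous (lead τ) (termComb τ)
  termComb-homogeneous (iterm a α _ (g₁ x y i) β) = scale-homogeneous a (rel₁-homogeneous α x y i β)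
  termComb-homogeneous (iterm a α _ (g₂ x y i j) β) = scale-homogeneous a (rel₂-homogeneous α x y i j β)

  Homogeneous⇒SupportedOn𝔖 : ∀ μ {v s} → Homogeneous v s → InSμ μ v → SupportedOn𝔖 μ s
  Homogeneous⇒SupportedOn𝔖 μ s∼v σ = All.map (λ p∼v → InSμ-resp-∼ μ (∼-sym p∼v) σ) s∼v

  module _ (μ : WeakComp) where

    relTermComb : RelTerm μ → Comb
    relTermComb r = scale (RelTerm.rcoef r) (RelTerm.rel r)

    relComb : List (RelTerm μ) → Comb
    relComb = concatMap relTermComb

    InRelSpan-resp-≋ : ∀ {s s′} → s ≋ s′ → InRelSpan μ s → InRelSpan μ s′
    InRelSpan-resp-≋ s≋s′ (rs , rs≋s) = rs , λ w → trans (rs≋s w) (s≋s′ w)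

    InRelSpan-++ : ∀ {s s′} → InRelSpan μ s → InRelSpan μ s′ → InRelSpan μ (s ++ s′)
    InRelSpan-++ {s} {s′} (rs , rs≋s) (rs′ , rs′≋s′) = rs ++ rs′ , λ w → begin
      coeff (relComb (rs ++ rs′)) w                 ≡⟨ cong (λ r → coeff r w) (List.concatMap-++ relTermComb rs rs′) ⟩
      coeff (relComb rs ++ relComb rs′) w           ≈⟨ coeff-++ (relComb rs) (relComb rs′) w ⟩
      coeff (relComb rs) w + coeff (relComb rs′) w  ≈⟨ +-cong (rs≋s w) (rs′≋s′ w) ⟩
      coeff s w + coeff s′ w                        ≈⟨ coeff-++ s s′ w ⟨
      coeff (s ++ s′) w                             ∎

    relation₁ : ∀ α x y i β → InSμ μ (α ++ (x , i) ∷ (y , i) ∷ β) → Relation μ (rel₁ α x y i β)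
    relation₁ α x y i β σ = r₁ α x y i β (adjacent-letters-distinct μ α β σ) (proj₁ (adjacent-colors-inSupp μ α β σ))
      (Homogeneous⇒SupportedOn𝔖 μ (rel₁-homogeneous α x y i β) σ)

    relation₂ : ∀ α x y i j β → ¬ i ≡ j → InSμ μ (α ++ (x , i) ∷ (y , j) ∷ β) → Relation μ (rel₂ α x y i j β)
    relation₂ α x y i j β i≢j σ =
      r₂ α x y i j β (adjacent-letters-distinct μ α β σ) i≢j (proj₁ supp) (proj₂ supp)
        (Homogeneous⇒SupportedOn𝔖 μ (rel₂-homogeneous α x y i j β) σ)
      where supp = adjacent-colors-inSupp μ α β σ

    idealTerm-inRelSpan : ∀ τ → InSμ μ (lead τ) → InRelSpan μ (termComb τ)
    idealTerm-inRelSpan (iterm a α _ (g₁ x y i) β) σ = rterm a _ (relation₁ α x y i β σ) ∷ [] , λ w → refl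
    idealTerm-inRelSpan (iterm a α _ (g₂ x y i j) β) σ with i ℕ.≟ j
    ... | no i≢j = rterm a _ (relation₂ α x y i j β i≢j σ) ∷ [] , λ w → refl
    -- rel₂ demands i ≢ j; for i = j the four-term generator is twice the two-term one.
    ... | yes ≡.refl = r ∷ r ∷ [] , coeff-resp-↭ (↭.prep p (↭.prep q (↭.swap p q ↭-refl)))
      where
      r = rterm a _ (relation₁ α x y i β σ)
      p q : Carrier × Word n
      p = a * 1# , α ++ (x , i) ∷ (y , i) ∷ β
      q = a * 1# , α ++ (y , i) ∷ (x , i) ∷ β

    idealSum-inRelSpan : ∀ τs → All (InSμ μ ∘ lead) τs → InRelSpan μ (concatMap termComb τs)
    idealSum-inRelSpan [] [] = [] , λ w → refl
    idealSum-inRelSpan (τ ∷ τs) (σ ∷ σs) = InRelSpan-++ {termComb τ} (idealTerm-inRelSpan τ σ) (idealSum-inRelSpan τs σs)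

    module _ (t : Comb) where

      Relevant? : ∀ τ → Dec (ContentOccurs t (lead τ))
      Relevant? τ = ContentOccurs? t (lead τ)

      relevantSum : List IdealTerm → Comb
      relevantSum τs = concatMap termComb (filter Relevant? τs)

      coeff-relevantSum-occurring : ∀ τs {w} → ContentOccurs t w → coeff (relevantSum τs) w ≈ coeff (concatMap termComb τs) w
      coeff-relevantSum-occurring [] occ = refl
      coeff-relevantSum-occurring (τ ∷ τs) {w} occ with Relevant? τ
      ... | yes _ = begin
        coeff (termComb τ ++ relevantSum τs) w                  ≈⟨ coeff-++ (termComb τ) _ w ⟩
        coeff (termComb τ) w + coeff (relevantSum τs) w         ≈⟨ +-cong refl (coeff-relevantSum-occurring τs occ) ⟩
        coeff (termComb τ) w + coeff (concatMap termComb τs) w  ≈⟨ coeff-++ (termComb τ) _ w ⟨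
        coeff (concatMap termComb (τ ∷ τs)) w                   ∎
      ... | no irrelevant = begin
        coeff (relevantSum τs) w                                ≈⟨ coeff-relevantSum-occurring τs occ ⟩
        coeff (concatMap termComb τs) w                         ≈⟨ +-identityˡ _ ⟨
        0# + coeff (concatMap termComb τs) w                    ≈⟨ +-cong (coeff-homogeneous _ (termComb-homogeneous τ) w≁τ) refl ⟨
        coeff (termComb τ) w + coeff (concatMap termComb τs) w  ≈⟨ coeff-++ (termComb τ) _ w ⟨
        coeff (concatMap termComb (τ ∷ τs)) w                   ∎
        where
        w≁τ : ¬ w ∼ lead τ
        w≁τ w∼τ = irrelevant (ContentOccurs-resp-∼ w∼τ occ)

      coeff-relevantSum-absent : ∀ τs {w} → ¬ ContentOccurs t w → coeff (relevantSum τs) w ≈ 0#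
      coeff-relevantSum-absent [] ¬occ = refl
      coeff-relevantSum-absent (τ ∷ τs) {w} ¬occ with Relevant? τ
      ... | yes relevant = begin
        coeff (termComb τ ++ relevantSum τs) w                ≈⟨ coeff-++ (termComb τ) _ w ⟩
        coeff (termComb τ) w + coeff (relevantSum τs) w       ≈⟨ +-cong (coeff-homogeneous _ (termComb-homogeneous τ) w≁τ)
                                                                        (coeff-relevantSum-absent τs ¬occ) ⟩
        0# + 0#                                               ≈⟨ +-identityˡ _ ⟩
        0#                                                    ∎
        where
        w≁τ : ¬ w ∼ lead τ
        w≁τ w∼τ = ¬occ (ContentOccurs-resp-∼ (∼-sym w∼τ) relevant)
      ... | no _ = coeff-relevantSum-absent τs ¬occ

      relevantSum-≋ : ∀ τs → concatMap termComb τs ≋ t → relevantSum τs ≋ t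
      relevantSum-≋ τs τs≋t w with ContentOccurs? t w
      ... | yes occ = trans (coeff-relevantSum-occurring τs occ) (τs≋t w)
      ... | no ¬occ = trans (coeff-relevantSum-absent τs ¬occ) (sym (coeff-absent t ¬occ))

      inIdeal⇒inRelSpan : SupportedOn𝔖 μ t → InIdeal t → InRelSpan μ t
      inIdeal⇒inRelSpan t⊆𝔖 (τs , τs≋t) = InRelSpan-resp-≋ {relevantSum τs} {t} (relevantSum-≋ τs τs≋t)
        (idealSum-inRelSpan (filter Relevant? τs) (All.map contentOccurs⇒InSμ (All.all-filter Relevant? τs)))
        where
        contentOccurs⇒InSμ : ∀ {w} → ContentOccurs t w → InSμ μ w
        contentOccurs⇒InSμ occ with All.lookupAny t⊆𝔖 occ
        ... | σ , p∼w = InSμ-resp-∼ μ p∼w σ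

    asIdealTerm : RelTerm μ → IdealTerm
    asIdealTerm (rterm a _ (r₁ α x y i β _ _ _)) = iterm a α (gen₁ x y i) (g₁ x y i) β
    asIdealTerm (rterm a _ (r₂ α x y i j β _ _ _ _ _)) = iterm a α (gen₂ x y i j) (g₂ x y i j) β

    termComb-asIdealTerm : ∀ r → termComb (asIdealTerm r) ≡ relTermComb r
    termComb-asIdealTerm (rterm _ _ (r₁ _ _ _ _ _ _ _ _)) = ≡.refl
    termComb-asIdealTerm (rterm _ _ (r₂ _ _ _ _ _ _ _ _ _ _ _)) = ≡.refl

    inRelSpan⇒inIdeal : ∀ t → InRelSpan μ t → InIdeal t
    inRelSpan⇒inIdeal _ (rs , rs≋t) = map asIdealTerm rs , λ w → trans (reflexive (cong (λ s → coeff s w) sums≡)) (rs≋t w)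
      where
      sums≡ : concatMap termComb (map asIdealTerm rs) ≡ relComb rs
      sums≡ = ≡.trans (List.concatMap-map termComb asIdealTerm rs) (List.concatMap-cong termComb-asIdealTerm rs)

proposition3p3 : ∀ {c ℓ} (K : Field c ℓ) → CharNot2 K →
    (n : ℕ) (μ : WeakComp) → IsWeakCompOf μ n →
    let open Tensor K n in
    ∀ (t : Comb) → SupportedOn𝔖 μ t → (WedgeZero t ⇔ InRelSpan μ t)
proposition3p3 K _ n μ _ t t⊆𝔖 = mk⇔ (inIdeal⇒inRelSpan K n μ t t⊆𝔖) (inRelSpan⇒inIdeal K n μ t)
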